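{- Let $G$ be a distance critical graph and $v \in V(G)$ such that $G - v$ is also distance critical. If $\deg_G(v) \le 3$, then $v$ is involved in some determining pair of $G$, i.e., there exist vertices $u, w \in V(G)$ such that $\{v,u\}$ is a determining pair for $w$ in $G$.
   Context: All graphs are finite, simple and undirected. For vertices $x,y$ of a graph $G$, $d_G(x,y)$ is the length of a shortest path from $x$ to $y$ in $G$ ($\infty$ if none exists). A graph $G$ is distance critical if for every vertex $v \in V(G)$ there exist vertices $x,y \in V(G)\setminus\{v\}$ with $d_G(x,y) \neq d_{G-v}(x,y)$. A pair of vertices $\{a,b\}$ is a determining pair for a vertex $v$ if $a$ and $b$ are distinct and nonadjacent and $v$ is their unique common neighbor. -}

module Defs where

open import Data.Nat using (ℕ; zero; suc; _≤_)
open import Data.Fin using (Fin; punchIn)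
open import Data.List using (List; length; filter; allFin)
open import Data.Maybe using (Maybe; just; nothing)
open import Data.Product using (Σ; ∃; ∃-syntax; _×_; _,_)
open import Data.Unit using (⊤)
open import Relation.Nullary using (¬_; Dec)
open import Relation.Binary.PropositionalEquality using (_≡_; _≢_)

record Graph (n : ℕ) : Set₁ where
  field
    Adj   : Fin n → Fin n → Set
    adj?  : ∀ x y → Dec (Adj x y)
    sym   : ∀ {x y} → Adj x y → Adj y x
    irrefl : ∀ {x} → ¬ Adj x x
open Graph public

-- G - v : delete vertex v; the vertices of G - v are Fin n,
-- identified with V(G) ∖ {v} via punchIn v.
_─_ : ∀ {n} → Graph (suc n) → Fin (suc n) → Graph n
G ─ v = record
  { Adj = λ x y → Adj G (punchIn v x) (punchIn v y)
  ; adj? = λ x y → adj? G (punchIn v x) (punchIn v y)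
  ; sym = sym G
  ; irrefl = irrefl G
  }

deg : ∀ {n} → Graph n → Fin n → ℕ
deg {n} G v = length (filter (adj? G v) (allFin n))

data Walk {n} (G : Graph n) : Fin n → Fin n → ℕ → Set where
  [] : ∀ {x} → Walk G x x 0
  _∷_ : ∀ {x y z k} → Adj G x y → Walk G y z k → Walk G x z (suc k)

-- d_G(x,y) = just k if the shortest x-y path has length k; nothing (= ∞) if none
Dist : ∀ {n} → Graph n → Fin n → Fin n → Maybe ℕ → Set
Dist G x y (just k) = Walk G x y k × (∀ m → Walk G x y m → k ≤ m)
Dist G x y nothing  = ∀ m → ¬ Walk G x y m

DistanceChanges : ∀ {n} → Graph (suc n) → Fin (suc n) → Fin n → Fin n → Set
DistanceChanges G v x y =
  ∃[ d₁ ] ∃[ d₂ ] (Dist G (punchIn v x) (punchIn v y) d₁ × Dist (G ─ v) x y d₂ × d₁ ≢ d₂)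

DistanceCritical : ∀ {n} → Graph n → Set
DistanceCritical {zero} G = ⊤
DistanceCritical {suc n} G = ∀ v → ∃[ x ] ∃[ y ] DistanceChanges G v x y

DeterminingPair : ∀ {n} → Graph n → Fin n → Fin n → Fin n → Set
DeterminingPair G a b w =
  a ≢ b × ¬ Adj G a b × Adj G a w × Adj G b w ×
  (∀ z → Adj G a z → Adj G b z → z ≡ w)

{-# OPTIONS --safe #-}
-- Deleting w changes some distance only if a shortest path passes through w; its two
-- neighbours x, y on that path are then nonadjacent, and a second common neighbour would
-- give a detour of the same length avoiding w, so {x, y} determines w. Hence some {a, b}
-- determines v in G and some {p, q} determines a in G − v. If neither {v, p} nor {v, q}
-- determines a, then each of p, q is equal or adjacent to a neighbour of v outside {a, b};
-- these two neighbours differ, as a common one would contradict that {p, q} determines a,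
-- so deg v ≥ 4.
module Submission where

open import Defs
open import Data.Nat using (ℕ; zero; suc; z≤n; _≤_)
open import Data.Nat.Properties
  using (≤-antisym; ≤-trans; ≤-pred; n≤1+n; 1+n≰n; module ≤-Reasoning)
open import Data.Fin using (Fin; punchIn; punchOut; _≟_)
open import Data.Fin.Properties
  using (¬Fin0; any?; punchIn-injective; punchInᵢ≢i; punchIn-punchOut)
open import Data.List using (List; []; _∷_; length; filter)
open import Data.List.Properties using (filter-notAll)
open import Data.List.Membership.Propositional using (_∈_)
open import Data.List.Membership.Propositional.Properties using (∈-filter⁺; ∈-allFin)
open import Data.List.Relation.Unary.All as All using (All; []; _∷_)
import Data.List.Relation.Unary.Any as Any
open import Data.List.Relation.Unary.AllPairs using ([]; _∷_)
open import Data.List.Relation.Unary.Unique.Propositional using (Unique)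
open import Data.Maybe using (just; nothing)
open import Data.Product using (∃-syntax; _×_; _,_; proj₁; proj₂)
open import Data.Sum using (_⊎_; inj₁; inj₂; [_,_]′) renaming (map₂ to ⊎-map₂)
open import Data.Empty using (⊥-elim)
open import Function using (_∘_; id)
open import Relation.Binary.Definitions using (DecidableEquality)
open import Relation.Nullary using (¬_; yes; no; ¬?; contradiction)
open import Relation.Nullary.Decidable using (decidable-stable)
open import Relation.Unary.Properties using (_∩?_; ∁?)
import Relation.Binary.PropositionalEquality as ≡
open ≡ using (_≡_; _≢_; refl; cong; subst; subst₂; ≢-sym)

unique⇒length≤ : ∀ {A : Set} → DecidableEquality A → {xs ys : List A} →
                 Unique ys → All (_∈ xs) ys → length ys ≤ length xs
unique⇒length≤ _≟_ [] [] = z≤n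
unique⇒length≤ _≟_ {xs} {y ∷ ys} (y∉ys ∷ ys!) (y∈xs ∷ ys⊆xs) = begin-strict
  length ys              ≤⟨ unique⇒length≤ _≟_ ys! (All.zipWith inWithoutY (y∉ys , ys⊆xs)) ⟩
  length (filter ≢y? xs) <⟨ filter-notAll ≢y? xs (Any.map (λ y≡x x≢y → x≢y (≡.sym y≡x)) y∈xs) ⟩
  length xs              ∎
  where
  open ≤-Reasoning
  ≢y? = λ x → ¬? (x ≟ y)
  inWithoutY : ∀ {x} → y ≢ x × x ∈ xs → x ∈ filter ≢y? xs
  inWithoutY (y≢x , x∈xs) = ∈-filter⁺ ≢y? x∈xs (≢-sym y≢x)

module _ {n} (G : Graph n) where

  adj⇒≢ : ∀ {x y} → Adj G x y → x ≢ y
  adj⇒≢ xy refl = irrefl G xy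

  distinctNeighbours⇒length≤deg : ∀ {v ys} → Unique ys → All (Adj G v) ys →
                                  length ys ≤ deg G v
  distinctNeighbours⇒length≤deg {v} ys! adjs =
    unique⇒length≤ _≟_ ys! (All.map (λ {x} → ∈-filter⁺ (adj? G v) (∈-allFin x)) adjs)

  HasDeterminingPair : Fin n → Set
  HasDeterminingPair w = ∃[ a ] ∃[ b ] DeterminingPair G a b w

  determiningPair⊎commonNeighbour : ∀ {a b w} → a ≢ b → ¬ Adj G a b → Adj G a w → Adj G b w →
    DeterminingPair G a b w ⊎ ∃[ z ] (z ≢ w × Adj G a z × Adj G b z)
  determiningPair⊎commonNeighbour {a} {b} {w} a≢b ¬ab aw bw
    with any? (adj? G a ∩? adj? G b ∩? ∁? (_≟ w))
  ... | yes (z , az , bz , z≢w) = inj₂ (z , z≢w , az , bz)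
  ... | no ∄z = inj₁ (a≢b , ¬ab , aw , bw , unique)
    where
    unique : ∀ z → Adj G a z → Adj G b z → z ≡ w
    unique z az bz = decidable-stable (z ≟ w) (λ z≢w → ∄z (z , az , bz , z≢w))

  Shortest : Fin n → Fin n → ℕ → Set
  Shortest x y k = ∀ j → Walk G x y j → k ≤ j

  shortest-tail : ∀ {x x₁ y k} → Adj G x x₁ → Shortest x y (suc k) → Shortest x₁ y k
  shortest-tail e short j W = ≤-pred (short (suc j) (e ∷ W))

  shortest⇒Dist≡just : ∀ {x y d k} → Dist G x y d → Walk G x y k → Shortest x y k →
                       d ≡ just k
  shortest⇒Dist≡just {d = nothing} unreachable W _ = ⊥-elim (unreachable _ W)
  shortest⇒Dist≡just {d = just _} (V , V-short) W short =
    cong just (≤-antisym (V-short _ W) (short _ V))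

module _ {m} (H : Graph (suc m)) (w : Fin (suc m)) where

  liftWalk : ∀ {x y k} → Walk (H ─ w) x y k → Walk H (punchIn w x) (punchIn w y) k
  liftWalk [] = []
  liftWalk (e ∷ W) = e ∷ liftWalk W

  -- The endpoints are tied to vertices of H ─ w by equations rather than by indices of
  -- the form punchIn w x, so that W can be matched on.
  mutual
    determined⊎walkAvoiding : ∀ {X Y k} (W : Walk H X Y k) → Shortest H X Y k →
      ∀ {x y} → punchIn w x ≡ X → punchIn w y ≡ Y →
      HasDeterminingPair H w ⊎ Walk (H ─ w) x y k
    determined⊎walkAvoiding [] _ {x} {y} refl y↑ with refl ← punchIn-injective w y x y↑ = inj₂ []
    determined⊎walkAvoiding (_∷_ {y = X₁} e W) short refl y↑ with X₁ ≟ w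
    ... | yes refl = determined⊎walkAvoidingVia e W short y↑
    ... | no X₁≢w = ⊎-map₂ (subst (Adj H _) (≡.sym X₁↑) e ∷_)
                          (determined⊎walkAvoiding W (shortest-tail H e short) X₁↑ y↑)
      where X₁↑ = punchIn-punchOut (X₁≢w ∘ ≡.sym)

    determined⊎walkAvoidingVia : ∀ {x Y y k} → Adj H (punchIn w x) w → (W : Walk H w Y k) →
      Shortest H (punchIn w x) Y (suc k) → punchIn w y ≡ Y →
      HasDeterminingPair H w ⊎ Walk (H ─ w) x y (suc k)
    determined⊎walkAvoidingVia {y = y} _ [] _ y↑ = contradiction y↑ (punchInᵢ≢i w y)
    determined⊎walkAvoidingVia {x} e₁ (_∷_ {y = X₂} e₂ W) short y↑ =
      [ (λ det → inj₁ (_ , _ , det)) , detour ]′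
        (determiningPair⊎commonNeighbour H X≢X₂ ¬XX₂ e₁ (sym H e₂))
      where
      X≢X₂ : punchIn w x ≢ X₂
      X≢X₂ refl = 1+n≰n (≤-trans (n≤1+n _) (short _ W))
      ¬XX₂ : ¬ Adj H (punchIn w x) X₂
      ¬XX₂ e = 1+n≰n (short _ (e ∷ W))
      detour : ∃[ z ] (z ≢ w × Adj H (punchIn w x) z × Adj H X₂ z) →
               HasDeterminingPair H w ⊎ Walk (H ─ w) x _ _
      detour (z , z≢w , Xz , X₂z) = ⊎-map₂ (λ W′ → Xz′ ∷ zX₂′ ∷ W′)
        (determined⊎walkAvoiding W (shortest-tail H e₂ (shortest-tail H e₁ short)) X₂↑ y↑)
        where
        z↑ = punchIn-punchOut (z≢w ∘ ≡.sym)
        X₂↑ = punchIn-punchOut (adj⇒≢ H e₂)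
        Xz′ = subst (Adj H _) (≡.sym z↑) Xz
        zX₂′ = subst₂ (Adj H) (≡.sym z↑) (≡.sym X₂↑) (sym H X₂z)

  distanceChanges⇒determined : ∀ {x y} → DistanceChanges H w x y → HasDeterminingPair H w
  distanceChanges⇒determined (nothing , nothing , _ , _ , d₁≢d₂) = contradiction refl d₁≢d₂
  distanceChanges⇒determined (nothing , just _ , unreachable , (W , _) , _) =
    ⊥-elim (unreachable _ (liftWalk W))
  distanceChanges⇒determined {x} {y} (just k , d₂ , (W , short) , D₂ , d₁≢d₂) =
    [ id , (λ W′ → contradiction (≡.sym (Dist─≡just W′)) d₁≢d₂) ]′
      (determined⊎walkAvoiding W short refl refl)
    where
    Dist─≡just : Walk (H ─ w) x y k → d₂ ≡ just k
    Dist─≡just W′ = shortest⇒Dist≡just (H ─ w) D₂ W′ (λ j → short j ∘ liftWalk)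

distanceCritical⇒determined : ∀ {n} (G : Graph (suc n)) → DistanceCritical G →
                              ∀ v → HasDeterminingPair G v
distanceCritical⇒determined G critical v =
  distanceChanges⇒determined G v (proj₂ (proj₂ (critical v)))

-- {a, b} is a determining pair for w in G − v, in the vertex names of G.
DeterminingPairAvoiding : ∀ {n} → Graph n → (v a b w : Fin n) → Set
DeterminingPairAvoiding G v a b w =
  a ≢ v × b ≢ v × a ≢ b × ¬ Adj G a b × Adj G a w × Adj G b w ×
  (∀ z → z ≢ v → Adj G a z → Adj G b z → z ≡ w)

determiningPair-punchIn : ∀ {m} (G : Graph (suc m)) v {a b w} →
  DeterminingPair (G ─ v) a b w →
  DeterminingPairAvoiding G v (punchIn v a) (punchIn v b) (punchIn v w)
determiningPair-punchIn G v {a} {b} {w} (a≢b , ¬ab , aw , bw , unique) =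
  punchInᵢ≢i v a , punchInᵢ≢i v b , a≢b ∘ punchIn-injective v a b , ¬ab , aw , bw , unique↑
  where
  unique↑ : ∀ z → z ≢ v → Adj G (punchIn v a) z → Adj G (punchIn v b) z → z ≡ punchIn v w
  unique↑ z z≢v az bz = begin
    z                                ≡⟨ ≡.sym z↑ ⟩
    punchIn v (punchOut (≢-sym z≢v)) ≡⟨ cong (punchIn v) (unique _ (lower az) (lower bz)) ⟩
    punchIn v w                      ∎
    where
    open ≡.≡-Reasoning
    z↑ = punchIn-punchOut (≢-sym z≢v)
    lower : ∀ {x} → Adj G x z → Adj G x (punchIn v (punchOut (≢-sym z≢v)))
    lower = subst (Adj G _) (≡.sym z↑)

InClosedNeighbourhood : ∀ {n} → Graph n → Fin n → Fin n → Set
InClosedNeighbourhood G u z = z ≡ u ⊎ Adj G u z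

module _ {n} (G : Graph n) where

  determiningPairWith⊎extraNeighbour : ∀ {v a b u} →
    DeterminingPair G a b v → u ≢ v → Adj G u a →
    DeterminingPair G v u a ⊎ ∃[ z ] (Adj G v z × z ≢ a × z ≢ b × InClosedNeighbourhood G u z)
  determiningPairWith⊎extraNeighbour {v} {a} {b} {u} (_ , ¬ab , av , _ , unique) u≢v ua
    with adj? G v u
  ... | yes vu = inj₂ (u , vu , adj⇒≢ G ua , (λ { refl → ¬ab (sym G ua) }) , inj₁ refl)
  ... | no ¬vu = ⊎-map₂ extra (determiningPair⊎commonNeighbour G (≢-sym u≢v) ¬vu (sym G av) ua)
    where
    extra : ∃[ z ] (z ≢ a × Adj G v z × Adj G u z) →
            ∃[ z ] (Adj G v z × z ≢ a × z ≢ b × InClosedNeighbourhood G u z)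
    extra (z , z≢a , vz , uz) =
      z , vz , z≢a , (λ { refl → u≢v (unique u (sym G ua) (sym G uz)) }) , inj₂ uz

  closedNeighbourhoods-disjoint : ∀ {v p q a z} →
    DeterminingPairAvoiding G v p q a → Adj G v z → z ≢ a →
    InClosedNeighbourhood G p z → ¬ InClosedNeighbourhood G q z
  closedNeighbourhoods-disjoint (_ , _ , p≢q , _ , _) _ _ (inj₁ refl) (inj₁ refl) = p≢q refl
  closedNeighbourhoods-disjoint (_ , _ , _ , ¬pq , _) _ _ (inj₁ refl) (inj₂ qp) = ¬pq (sym G qp)
  closedNeighbourhoods-disjoint (_ , _ , _ , ¬pq , _) _ _ (inj₂ pq) (inj₁ refl) = ¬pq pq
  closedNeighbourhoods-disjoint (_ , _ , _ , _ , _ , _ , unique) vz z≢a (inj₂ pz) (inj₂ qz) =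
    z≢a (unique _ (≢-sym (adj⇒≢ G vz)) pz qz)

  determiningPairWith : ∀ {v a b p q} →
    DeterminingPair G a b v → DeterminingPairAvoiding G v p q a → deg G v ≤ 3 →
    ∃[ u ] DeterminingPair G v u a
  determiningPairWith {v} ab→v@(a≢b , _ , av , bv , _) pq→a@(p≢v , q≢v , _ , _ , pa , qa , _) deg≤3
    with determiningPairWith⊎extraNeighbour ab→v p≢v pa
       | determiningPairWith⊎extraNeighbour ab→v q≢v qa
  ... | inj₁ vp→a | _ = _ , vp→a
  ... | inj₂ _ | inj₁ vq→a = _ , vq→a
  ... | inj₂ (z₁ , vz₁ , z₁≢a , z₁≢b , pz₁) | inj₂ (z₂ , vz₂ , z₂≢a , z₂≢b , qz₂) =
    contradiction (≤-trans 4≤deg deg≤3) 1+n≰n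
    where
    z₁≢z₂ : z₁ ≢ z₂
    z₁≢z₂ refl = closedNeighbourhoods-disjoint pq→a vz₁ z₁≢a pz₁ qz₂
    4≤deg : 4 ≤ deg G v
    4≤deg = distinctNeighbours⇒length≤deg G
      ( (a≢b ∷ ≢-sym z₁≢a ∷ ≢-sym z₂≢a ∷ [])
      ∷ (≢-sym z₁≢b ∷ ≢-sym z₂≢b ∷ [])
      ∷ (z₁≢z₂ ∷ [])
      ∷ [] ∷ [])
      (sym G av ∷ sym G bv ∷ vz₁ ∷ vz₂ ∷ [])

lemma3p5 : ∀ {n} (G : Graph (suc n)) (v : Fin (suc n)) →
    DistanceCritical G → DistanceCritical (G ─ v) → deg G v ≤ 3 →
    ∃[ u ] ∃[ w ] DeterminingPair G v u w
lemma3p5 {zero} G v critical _ _ = contradiction (proj₁ (critical v)) ¬Fin0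
lemma3p5 {suc _} G v critical critical─v deg≤3
  with distanceCritical⇒determined G critical v
... | a , _ , ab→v@(_ , _ , av , _)
  with distanceCritical⇒determined (G ─ v) critical─v (punchOut (≢-sym (adj⇒≢ G av)))
... | p , q , pq→a′ =
  let u , vu→a = determiningPairWith G ab→v pq→a deg≤3 in u , a , vu→a
  where
  pq→a : DeterminingPairAvoiding G v (punchIn v p) (punchIn v q) a
  pq→a = subst (DeterminingPairAvoiding G v _ _) (punchIn-punchOut _)
               (determiningPair-punchIn G v pq→a′)
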